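{- Let $\mu$ be a partition with at most $n$ parts and $\mathbf a\in\mathbb N^n$. Then the sum $\sum_U\operatorname{sgn}(U)$, taken over special snake tabloids $U$ of weight $\mathbf a$ and shape $\mathrm{rev}(\mu)=(\mu_n,\dots,\mu_1)$, is cancellation-free, i.e. its terms are not both positive and negative.
   Context: Cells $(c,r)$: column $c$, row $r$, row 1 at the bottom. For $\mathbf b\in\mathbb N^n$, $\mathbb D(\mathbf b)=\{(c,r)\in\mathbb Z_{>0}\times[n]:c\le\mathbf b_r\}$. Key poset: $\mathbf a\preceq\mathbf b$ iff $\mathbf a_i\le\mathbf b_i$ for all $i$, and $\mathbf a_i>\mathbf a_j$ with $i<j$ implies $\mathbf b_i>\mathbf b_j$. Two cells are weakly connected if they share a column or lie in adjacent columns with the left cell weakly higher; a set is weakly connected if it forms a single class under the transitive closure of this relation. A snake of $\mathbf b$ is $S\subseteq\mathbb D(\mathbf b)$ such that (1) $S$ is weakly connected, (2) $\mathbb D(\mathbf b)\setminus S=\mathbb D(\mathbf a)$ for some $\mathbf a\preceq\mathbf b$, (3) $S$ contains no three cells $(c,s),(c+1,s),(c+1,r)$ with $r<s$. A snake is special if it is empty or contains the lowest cell of column 1 of the key diagram. A special snake tabloid $U=(S_1,\dots,S_n)$ of shape $\mathbf b$ is a decomposition $\mathbb D(\mathbf b)=S_1\sqcup\cdots\sqcup S_n$ such that each $S_i$ is a special snake of the key diagram $\mathbb D(\mathbf b)\setminus(S_1\sqcup\cdots\sqcup S_{i-1})$, with $S_i=\emptyset$ if and only if row $i$ of that diagram is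 empty. Its weight is $(|S_1|,\dots,|S_n|)$. The height of a snake is the number of rows containing a cell of it (height of $\emptyset$ is 1), its sign is $(-1)^{\mathrm{height}-1}$, and $\operatorname{sgn}(U)$ is the product of the signs of its snakes. -}

module Defs where

open import Data.Nat using (ℕ; zero; suc; _+_; _∸_; _≤_; _<_)
open import Data.Fin using (Fin; toℕ; opposite)
import Data.Fin as F
open import Data.Bool using (Bool; true; false; if_then_else_; _∨_)
open import Data.Integer using (ℤ; +_; -_; _*_)
open import Data.Product using (Σ; Σ-syntax; _×_; _,_)
open import Data.Sum using (_⊎_)
open import Relation.Nullary using (¬_)
open import Relation.Binary.PropositionalEquality using (_≡_)
open import Relation.Binary.Construct.Closure.ReflexiveTransitive using (Star)

_⇔_ : Set → Set → Set
A ⇔ B = (A → B) × (B → A)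

-- Cells (c , r): column c (a natural number; only c ≥ 1 occur in diagrams),
-- row r ∈ Fin n, where Fin.zero is row 1 (the bottom row).
Cell : ℕ → Set
Cell n = ℕ × Fin n

CellSet : ℕ → Set
CellSet n = Cell n → Bool

_∈_ : ∀ {n} → Cell n → CellSet n → Set
x ∈ S = S x ≡ true

IsEmpty : ∀ {n} → CellSet n → Set
IsEmpty S = ∀ x → ¬ (x ∈ S)

InD : ∀ {n} → (Fin n → ℕ) → Cell n → Set
InD b (c , r) = 1 ≤ c × c ≤ b r

_⪯_ : ∀ {n} → (Fin n → ℕ) → (Fin n → ℕ) → Set
a ⪯ b = (∀ i → a i ≤ b i)
      × (∀ i j → i F.< j → a j < a i → b j < b i)

WC : ∀ {n} → Cell n → Cell n → Set
WC (c , s) (c' , r) =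
  c ≡ c'
  ⊎ (suc c ≡ c' × toℕ r ≤ toℕ s)
  ⊎ (suc c' ≡ c × toℕ s ≤ toℕ r)

WeaklyConnected : ∀ {n} → CellSet n → Set
WeaklyConnected S =
  ∀ x y → x ∈ S → y ∈ S → Star (λ u v → u ∈ S × v ∈ S × WC u v) x y

IsSnake : ∀ {n} → (Fin n → ℕ) → CellSet n → Set
IsSnake {n} b S =
  (∀ x → x ∈ S → InD b x)
  × WeaklyConnected S
  × (Σ[ a ∈ (Fin n → ℕ) ] (a ⪯ b × (∀ x → (InD b x × ¬ (x ∈ S)) ⇔ InD a x)))
  × (∀ (c : ℕ) (s r : Fin n) → toℕ r < toℕ s →
       ¬ ((c , s) ∈ S × (suc c , s) ∈ S × (suc c , r) ∈ S))

IsSpecial : ∀ {n} → (Fin n → ℕ) → CellSet n → Set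
IsSpecial {n} b S =
  IsEmpty S
  ⊎ (Σ[ r ∈ Fin n ] (1 ≤ b r × (∀ r' → r' F.< r → b r' ≡ 0) × (1 , r) ∈ S))

Remaining : ∀ {n} → (Fin n → ℕ) → (Fin n → CellSet n) → Fin n → Cell n → Set
Remaining b U i x = InD b x × (∀ j → j F.< i → ¬ (x ∈ U j))

-- Special snake tabloid of shape b: U i is the snake S_{i+1}
IsSST : ∀ {n} → (Fin n → ℕ) → (Fin n → CellSet n) → Set
IsSST {n} b U =
  (∀ i → Σ[ b' ∈ (Fin n → ℕ) ]
           ((∀ x → Remaining b U i x ⇔ InD b' x)
            × IsSnake b' (U i)
            × IsSpecial b' (U i)
            × (IsEmpty (U i) ⇔ (b' i ≡ 0))))
  × (∀ x → InD b x → Σ[ i ∈ Fin n ] (x ∈ U i × (∀ j → x ∈ U j → j ≡ i)))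
  × (∀ i x → x ∈ U i → InD b x)

sumFin : ∀ {n} → (Fin n → ℕ) → ℕ
sumFin {zero} f = 0
sumFin {suc n} f = f F.zero + sumFin (λ i → f (F.suc i))

anyFin : ∀ {n} → (Fin n → Bool) → Bool
anyFin {zero} f = false
anyFin {suc n} f = f F.zero ∨ anyFin (λ i → f (F.suc i))

prodFin : ∀ {n} → (Fin n → ℤ) → ℤ
prodFin {zero} f = + 1
prodFin {suc n} f = f F.zero * prodFin (λ i → f (F.suc i))

-- sum over columns c = 1 .. N
sumCols : ℕ → (ℕ → ℕ) → ℕ
sumCols zero g = 0
sumCols (suc N) g = g (suc N) + sumCols N g

anyCols : ℕ → (ℕ → Bool) → Bool
anyCols zero g = false
anyCols (suc N) g = g (suc N) ∨ anyCols N g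

χ : Bool → ℕ
χ true = 1
χ false = 0

sizeUpTo : ∀ {n} → ℕ → CellSet n → ℕ
sizeUpTo N S = sumCols N (λ c → sumFin (λ r → χ (S (c , r))))

heightUpTo : ∀ {n} → ℕ → CellSet n → ℕ
heightUpTo N S with sumFin (λ r → χ (anyCols N (λ c → S (c , r))))
... | zero = 1
... | suc k = suc k

negOnePow : ℕ → ℤ
negOnePow zero = + 1
negOnePow (suc k) = - negOnePow k

-- Since all snakes of a tabloid of shape b lie in D(b), whose columns are
-- at most sumFin b, this bound computes sizes and heights exactly.
weightOf : ∀ {n} → (Fin n → ℕ) → (Fin n → CellSet n) → Fin n → ℕ
weightOf b U i = sizeUpTo (sumFin b) (U i)

sgnOf : ∀ {n} → (Fin n → ℕ) → (Fin n → CellSet n) → ℤ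
sgnOf b U = prodFin (λ i → negOnePow (heightUpTo (sumFin b) (U i) ∸ 1))

-- partitions with at most n parts: weakly decreasing μ : Fin n → ℕ
IsPartition : ∀ {n} → (Fin n → ℕ) → Set
IsPartition μ = ∀ i j → i F.≤ j → μ j ≤ μ i

rev : ∀ {n} → (Fin n → ℕ) → Fin n → ℕ
rev μ i = μ (opposite i)

{-# OPTIONS --safe #-}

-- The shape rev μ weakly increases from the bottom row up, and so does every shape
-- that remains while a special snake tabloid of shape rev μ is peeled off snake by snake.
-- In a weakly increasing shape b, a nonempty special snake starts in column 1 of the
-- lowest nonempty row r₀; the no-hook condition and weak connectivity force it, in each
-- row r above r₀, either to have left rows r, r+1, … for good, or to consist in row r
-- exactly of the cells from column b(r-1) on. Stopping earlier gives a smaller snake,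
-- so the snake is determined by its size. Inductively a tabloid is determined by its
-- weight, and two tabloids of the same weight have the same sign.
module Submission where

open import Defs
open import Data.Nat using (ℕ; zero; suc; _+_; _∸_; _≤_; _<_; _⊓_; z≤n; s≤s; _≤?_; _≟_)
open import Data.Nat.Properties
open import Algebra.Properties.CommutativeSemigroup +-commutativeSemigroup using (interchange)
open import Data.Fin using (Fin; toℕ; opposite)
import Data.Fin as F
import Data.Fin.Properties as FP
open import Data.Fin.Induction using (<-wellFounded)
open import Data.Bool using (Bool; true; false; _∨_)
import Data.Bool.Properties as BP
open import Data.Integer using (ℤ; +_; -_; _*_)
open import Data.Product using (Σ-syntax; _×_; _,_; proj₁; proj₂)
open import Data.Sum using (inj₁; inj₂)
open import Data.Empty using (⊥-elim)
open import Function using (_∘_)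
open import Induction.WellFounded using (module All)
open import Level using (0ℓ)
open import Relation.Nullary using (¬_; yes; no; contradiction)
open import Relation.Nullary.Decidable using (⌊_⌋)
open import Relation.Binary.PropositionalEquality
open import Relation.Binary.Definitions using (tri<; tri≈; tri>)
open import Relation.Binary.Construct.Closure.ReflexiveTransitive using (Star; ε; _◅_)

sumFin-cong : ∀ {n} {f g : Fin n → ℕ} → f ≗ g → sumFin f ≡ sumFin g
sumFin-cong {zero} f≗g = refl
sumFin-cong {suc n} f≗g = cong₂ _+_ (f≗g F.zero) (sumFin-cong (f≗g ∘ F.suc))

sumFin-zero : ∀ n → sumFin {n} (λ _ → 0) ≡ 0
sumFin-zero zero = refl
sumFin-zero (suc n) = sumFin-zero n

sumFin-distrib-+ : ∀ {n} (f g : Fin n → ℕ) → sumFin (λ i → f i + g i) ≡ sumFin f + sumFin g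
sumFin-distrib-+ {zero} f g = refl
sumFin-distrib-+ {suc n} f g =
  trans (cong (_+_ (f F.zero + g F.zero)) (sumFin-distrib-+ (f ∘ F.suc) (g ∘ F.suc)))
        (interchange (f F.zero) (g F.zero) _ _)

sumFin-mono-≤ : ∀ {n} {f g : Fin n → ℕ} → (∀ i → f i ≤ g i) → sumFin f ≤ sumFin g
sumFin-mono-≤ {zero} f≤g = z≤n
sumFin-mono-≤ {suc n} f≤g = +-mono-≤ (f≤g F.zero) (sumFin-mono-≤ (f≤g ∘ F.suc))

sumFin-mono-< : ∀ {n} {f g : Fin n → ℕ} → (∀ i → f i ≤ g i) → ∀ i → f i < g i → sumFin f < sumFin g
sumFin-mono-< f≤g F.zero fi<gi = +-mono-<-≤ fi<gi (sumFin-mono-≤ (f≤g ∘ F.suc))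
sumFin-mono-< f≤g (F.suc i) fi<gi = +-mono-≤-< (f≤g F.zero) (sumFin-mono-< (f≤g ∘ F.suc) i fi<gi)

≤-sumFin : ∀ {n} (f : Fin n → ℕ) i → f i ≤ sumFin f
≤-sumFin f F.zero = m≤m+n _ _
≤-sumFin f (F.suc i) = ≤-trans (≤-sumFin (f ∘ F.suc) i) (m≤n+m _ _)

sumCols-cong : ∀ N {f g : ℕ → ℕ} → (∀ k → f (suc k) ≡ g (suc k)) → sumCols N f ≡ sumCols N g
sumCols-cong zero f≗g = refl
sumCols-cong (suc N) f≗g = cong₂ _+_ (f≗g N) (sumCols-cong N f≗g)

sumCols-distrib-+ : ∀ N (f g : ℕ → ℕ) → sumCols N (λ c → f c + g c) ≡ sumCols N f + sumCols N g
sumCols-distrib-+ zero f g = refl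
sumCols-distrib-+ (suc N) f g =
  trans (cong (_+_ (f (suc N) + g (suc N))) (sumCols-distrib-+ N f g))
        (interchange (f (suc N)) (g (suc N)) _ _)

sumCols-sumFin-comm : ∀ {n} N (f : ℕ → Fin n → ℕ) →
  sumCols N (λ c → sumFin (f c)) ≡ sumFin (λ r → sumCols N (λ c → f c r))
sumCols-sumFin-comm {n} zero f = sym (sumFin-zero n)
sumCols-sumFin-comm (suc N) f =
  trans (cong (_+_ (sumFin (f (suc N)))) (sumCols-sumFin-comm N f))
        (sym (sumFin-distrib-+ (f (suc N)) _))

sumCols-χ≤ : ∀ N m → sumCols N (λ c → χ ⌊ c ≤? m ⌋) ≡ N ⊓ m
sumCols-χ≤ zero m = refl
sumCols-χ≤ (suc N) m with suc N ≤? m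
... | yes N<m rewrite sumCols-χ≤ N m | m≤n⇒m⊓n≡m N<m | m≤n⇒m⊓n≡m (<⇒≤ N<m) = refl
... | no N≮m rewrite sumCols-χ≤ N m | m≥n⇒m⊓n≡n (≤-pred (≰⇒> N≮m))
                                    | m≥n⇒m⊓n≡n (m≤n⇒m≤1+n (≤-pred (≰⇒> N≮m))) = refl

prodFin-cong : ∀ {n} {f g : Fin n → ℤ} → f ≗ g → prodFin f ≡ prodFin g
prodFin-cong {zero} f≗g = refl
prodFin-cong {suc n} f≗g = cong₂ _*_ (f≗g F.zero) (prodFin-cong (f≗g ∘ F.suc))

anyCols-cong : ∀ N {f g : ℕ → Bool} → f ≗ g → anyCols N f ≡ anyCols N g
anyCols-cong zero f≗g = refl
anyCols-cong (suc N) f≗g = cong₂ _∨_ (f≗g (suc N)) (anyCols-cong N f≗g)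

heightUpTo-cong : ∀ {n} N {S S' : CellSet n} → S ≗ S' → heightUpTo N S ≡ heightUpTo N S'
heightUpTo-cong N {S} {S'} S≗S'
  with sumFin (λ r → χ (anyCols N (λ c → S (c , r))))
     | sumFin (λ r → χ (anyCols N (λ c → S' (c , r))))
     | sumFin-cong (λ r → cong χ (anyCols-cong N (λ c → S≗S' (c , r))))
... | zero  | _ | refl = refl
... | suc k | _ | refl = refl

sgnOf-cong : ∀ {n} (b : Fin n → ℕ) {U V : Fin n → CellSet n} → (∀ i → U i ≗ V i) → sgnOf b U ≡ sgnOf b V
sgnOf-cong b U≗V = prodFin-cong (λ i → cong (λ h → negOnePow (h ∸ 1)) (heightUpTo-cong (sumFin b) (U≗V i)))

bool-ext : ∀ {x y : Bool} → (x ≡ true → y ≡ true) → (y ≡ true → x ≡ true) → x ≡ y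
bool-ext {false} {false} _ _ = refl
bool-ext {false} {true} _ y⇒x = y⇒x refl
bool-ext {true} {false} x⇒y _ = sym (x⇒y refl)
bool-ext {true} {true} _ _ = refl

⇔-trans : ∀ {A B C : Set} → A ⇔ B → B ⇔ C → A ⇔ C
⇔-trans (f , g) (h , k) = h ∘ f , g ∘ k

⇔-sym : ∀ {A B : Set} → A ⇔ B → B ⇔ A
⇔-sym (f , g) = g , f

WeaklyIncreasing : ∀ {n} → (Fin n → ℕ) → Set
WeaklyIncreasing b = ∀ {r s} → r F.≤ s → b r ≤ b s

WeaklyIncreasing-resp : ∀ {n} {b b' : Fin n → ℕ} → b ≗ b' → WeaklyIncreasing b → WeaklyIncreasing b'
WeaklyIncreasing-resp b≗b' b-inc {r} {s} r≤s = subst₂ _≤_ (b≗b' r) (b≗b' s) (b-inc r≤s)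

⪯-preserves-increasing : ∀ {n} {a b : Fin n → ℕ} → a ⪯ b → WeaklyIncreasing b → WeaklyIncreasing a
⪯-preserves-increasing {a = a} (_ , key) b-inc {r} {s} r≤s with a r ≤? a s
... | yes ar≤as = ar≤as
... | no ar≰as with m≤n⇒m<n∨m≡n r≤s
...   | inj₁ r<s = contradiction (b-inc r≤s) (<⇒≱ (key r s r<s (≰⇒> ar≰as)))
...   | inj₂ r≡s = contradiction (≤-reflexive (cong a (FP.toℕ-injective r≡s))) ar≰as

rev-increasing : ∀ {n} {μ : Fin n → ℕ} → IsPartition μ → WeaklyIncreasing (rev μ)
rev-increasing {n} {μ} μ-partition {r} {s} r≤s = μ-partition (opposite s) (opposite r)
  (subst₂ _≤_ (sym (FP.opposite-prop s)) (sym (FP.opposite-prop r)) (∸-monoʳ-≤ n (s≤s r≤s)))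

_⋖_ : ∀ {n} → Fin n → Fin n → Set
p ⋖ r = toℕ r ≡ suc (toℕ p)

inject₁⋖suc : ∀ {n} (j : Fin n) → F.inject₁ j ⋖ F.suc j
inject₁⋖suc j = cong suc (sym (FP.toℕ-inject₁ j))

predecessor : ∀ {n} {q r : Fin n} → q F.< r → Σ[ p ∈ Fin n ] (p ⋖ r × q F.≤ p)
predecessor {q = q} {F.suc j} q<r =
  F.inject₁ j , inject₁⋖suc j , ≤-pred (subst (toℕ q <_) (inject₁⋖suc j) q<r)

⋖⇒≤ : ∀ {n} {p r : Fin n} → p ⋖ r → p F.≤ r
⋖⇒≤ {p = p} p⋖r = subst (toℕ p ≤_) (sym p⋖r) (n≤1+n _)

⋖⇒< : ∀ {n} {p r : Fin n} → p ⋖ r → p F.< r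
⋖⇒< p⋖r = ≤-reflexive (sym p⋖r)

InD-⊆⇒≤ : ∀ {n} {a b : Fin n → ℕ} → (∀ x → InD a x → InD b x) → ∀ r → a r ≤ b r
InD-⊆⇒≤ {a = a} D[a]⊆D[b] r with a r in ar≡
... | zero = z≤n
... | suc k = proj₂ (D[a]⊆D[b] (suc k , r) (s≤s z≤n , ≤-reflexive (sym ar≡)))

InD-injective : ∀ {n} {a b : Fin n → ℕ} → (∀ x → InD a x ⇔ InD b x) → a ≗ b
InD-injective D[a]⇔D[b] r =
  ≤-antisym (InD-⊆⇒≤ (proj₁ ∘ D[a]⇔D[b]) r) (InD-⊆⇒≤ (proj₂ ∘ D[a]⇔D[b]) r)

InD-resp : ∀ {n} {a b : Fin n → ℕ} → a ≗ b → ∀ x → InD a x → InD b x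
InD-resp a≗b (c , r) (1≤c , c≤ar) = 1≤c , subst (c ≤_) (a≗b r) c≤ar

⪯-respʳ : ∀ {n} {a b b' : Fin n → ℕ} → b ≗ b' → a ⪯ b → a ⪯ b'
⪯-respʳ {a = a} b≗b' (a≤b , key) =
  (λ i → subst (a i ≤_) (b≗b' i) (a≤b i)) ,
  (λ i j i<j aj<ai → subst₂ _<_ (b≗b' j) (b≗b' i) (key i j i<j aj<ai))

IsSnake-resp : ∀ {n} {b b' : Fin n → ℕ} {S : CellSet n} → b ≗ b' → IsSnake b S → IsSnake b' S
IsSnake-resp b≗b' (S⊆D , connected , (a , a⪯b , complement) , hook-free) =
  (λ x x∈S → InD-resp b≗b' x (S⊆D x x∈S)) ,
  connected ,
  (a , ⪯-respʳ b≗b' a⪯b ,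
    λ x → (λ (x∈D , x∉S) → proj₁ (complement x) (InD-resp (sym ∘ b≗b') x x∈D , x∉S)) ,
          (λ x∈Da → let (x∈D , x∉S) = proj₂ (complement x) x∈Da in InD-resp b≗b' x x∈D , x∉S)) ,
  hook-free

IsSpecial-resp : ∀ {n} {b b' : Fin n → ℕ} {S : CellSet n} → b ≗ b' → IsSpecial b S → IsSpecial b' S
IsSpecial-resp b≗b' (inj₁ empty) = inj₁ empty
IsSpecial-resp b≗b' (inj₂ (r₀ , 1≤br₀ , below , start)) =
  inj₂ (r₀ , subst (1 ≤_) (b≗b' r₀) 1≤br₀ , (λ r r<r₀ → trans (sym (b≗b' r)) (below r r<r₀)) , start)

lowest-nonempty-row-unique : ∀ {n} {b : Fin n → ℕ} {r s : Fin n} →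
  1 ≤ b r → (∀ q → q F.< r → b q ≡ 0) → 1 ≤ b s → (∀ q → q F.< s → b q ≡ 0) → r ≡ s
lowest-nonempty-row-unique {r = r} {s} 1≤br below-r 1≤bs below-s with FP.<-cmp r s
... | tri< r<s _ _ = contradiction (subst (1 ≤_) (below-s r r<s) 1≤br) λ ()
... | tri≈ _ r≡s _ = r≡s
... | tri> _ _ s<r = contradiction (subst (1 ≤_) (below-r s s<r) 1≤bs) λ ()

-- The properties of the shape left by a snake through (1, r₀) that determine it by its total.
record SnakeProfile {n} (b : Fin n → ℕ) (r₀ : Fin n) : Set where
  field
    inner       : Fin n → ℕ
    inner≤shape : ∀ r → inner r ≤ b r
    inner-start : inner r₀ ≡ 0
    hook-free   : ∀ {p r} → p ⋖ r → b p ≤ suc (inner r)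
    stops       : ∀ {p r} → p ⋖ r → r₀ F.≤ p → b p ≤ inner r → ∀ {s} → r F.≤ s → b s ≤ inner s

innerShape : ∀ {n} {b : Fin n → ℕ} {S : CellSet n} → IsSnake b S → Fin n → ℕ
innerShape snake = proj₁ (proj₁ (proj₂ (proj₂ snake)))

innerShape-⪯ : ∀ {n} {b : Fin n → ℕ} {S : CellSet n} (snake : IsSnake b S) → innerShape snake ⪯ b
innerShape-⪯ snake = proj₁ (proj₂ (proj₁ (proj₂ (proj₂ snake))))

innerShape-complement : ∀ {n} {b : Fin n → ℕ} {S : CellSet n} (snake : IsSnake b S) →
  ∀ x → (InD b x × ¬ (x ∈ S)) ⇔ InD (innerShape snake) x
innerShape-complement snake = proj₂ (proj₂ (proj₁ (proj₂ (proj₂ snake))))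

module Snake {n} {b : Fin n → ℕ} (b-inc : WeaklyIncreasing b) {S : CellSet n} (snake : IsSnake b S) where

  inner : Fin n → ℕ
  inner = innerShape snake

  private
    S⊆D : ∀ x → x ∈ S → InD b x
    S⊆D = proj₁ snake

    connected : WeaklyConnected S
    connected = proj₁ (proj₂ snake)

    inner⪯b : inner ⪯ b
    inner⪯b = innerShape-⪯ snake

    complement : ∀ x → (InD b x × ¬ (x ∈ S)) ⇔ InD inner x
    complement = innerShape-complement snake

    no-hook : ∀ c (s r : Fin n) → toℕ r < toℕ s → ¬ ((c , s) ∈ S × (suc c , s) ∈ S × (suc c , r) ∈ S)
    no-hook = proj₂ (proj₂ (proj₂ snake))

  inner≤shape : ∀ r → inner r ≤ b r
  inner≤shape = proj₁ inner⪯b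

  inner-inc : WeaklyIncreasing inner
  inner-inc = ⪯-preserves-increasing inner⪯b b-inc

  ∈⇒∉inner : ∀ {x} → x ∈ S → ¬ InD inner x
  ∈⇒∉inner {x} x∈S x∈Da = proj₂ (proj₂ (complement x) x∈Da) x∈S

  ∉inner⇒∈ : ∀ {x} → InD b x → ¬ InD inner x → x ∈ S
  ∉inner⇒∈ {x} x∈D x∉Da with S x BP.≟ true
  ... | yes x∈S = x∈S
  ... | no x∉S = contradiction (proj₁ (complement x) (x∈D , x∉S)) x∉Da

  ∈⇔outside-inner : ∀ x → (x ∈ S) ⇔ (InD b x × ¬ InD inner x)
  ∈⇔outside-inner x = (λ x∈S → S⊆D x x∈S , ∈⇒∉inner x∈S) , λ (x∈D , x∉Da) → ∉inner⇒∈ x∈D x∉Da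

  outside-inner⇒∈ : ∀ {c q} → 1 ≤ c → c ≤ b q → inner q < c → (c , q) ∈ S
  outside-inner⇒∈ 1≤c c≤bq inner<c = ∉inner⇒∈ (1≤c , c≤bq) (<⇒≱ inner<c ∘ proj₂)

  ∈⇒inner< : ∀ {c q} → (c , q) ∈ S → inner q < c
  ∈⇒inner< {c} {q} x∈S = ≰⇒> (λ c≤inner → ∈⇒∉inner x∈S (proj₁ (S⊆D (c , q) x∈S) , c≤inner))

  row-cell : ∀ r k → χ (S (suc k , r)) + χ ⌊ suc k ≤? inner r ⌋ ≡ χ ⌊ suc k ≤? b r ⌋
  row-cell r k with suc k ≤? inner r | suc k ≤? b r
  ... | yes k<a | yes _ rewrite BP.¬-not (λ x∈S → ∈⇒∉inner x∈S (s≤s z≤n , k<a)) = refl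
  ... | yes k<a | no k≮b = contradiction (≤-trans k<a (inner≤shape r)) k≮b
  ... | no k≮a | yes k<b rewrite ∉inner⇒∈ (s≤s z≤n , k<b) (k≮a ∘ proj₂) = refl
  ... | no _ | no k≮b rewrite BP.¬-not (λ x∈S → k≮b (proj₂ (S⊆D (suc k , r) x∈S))) = refl

  row-size : ∀ N r → b r ≤ N → sumCols N (λ c → χ (S (c , r))) + inner r ≡ b r
  row-size N r br≤N = begin
    sumCols N (λ c → χ (S (c , r))) + inner r
      ≡⟨ cong (_+_ (sumCols N (λ c → χ (S (c , r)))))
              (sym (trans (sumCols-χ≤ N (inner r)) (m≥n⇒m⊓n≡n (≤-trans (inner≤shape r) br≤N)))) ⟩
    sumCols N (λ c → χ (S (c , r))) + sumCols N (λ c → χ ⌊ c ≤? inner r ⌋)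
      ≡⟨ sym (sumCols-distrib-+ N _ _) ⟩
    sumCols N (λ c → χ (S (c , r)) + χ ⌊ c ≤? inner r ⌋)
      ≡⟨ sumCols-cong N (row-cell r) ⟩
    sumCols N (λ c → χ ⌊ c ≤? b r ⌋)
      ≡⟨ trans (sumCols-χ≤ N (b r)) (m≥n⇒m⊓n≡n br≤N) ⟩
    b r ∎
    where open ≡-Reasoning

  size : ∀ N → (∀ r → b r ≤ N) → sizeUpTo N S + sumFin inner ≡ sumFin b
  size N b≤N = begin
    sumCols N (λ c → sumFin (λ r → χ (S (c , r)))) + sumFin inner
      ≡⟨ cong (_+ sumFin inner) (sumCols-sumFin-comm N (λ c r → χ (S (c , r)))) ⟩
    sumFin (λ r → sumCols N (λ c → χ (S (c , r)))) + sumFin inner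
      ≡⟨ sym (sumFin-distrib-+ _ inner) ⟩
    sumFin (λ r → sumCols N (λ c → χ (S (c , r))) + inner r)
      ≡⟨ sumFin-cong (λ r → row-size N r (b≤N r)) ⟩
    sumFin b ∎
    where open ≡-Reasoning

  inner-start : ∀ {r₀} → (1 , r₀) ∈ S → inner r₀ ≡ 0
  inner-start start = n<1⇒n≡0 (∈⇒inner< start)

  -- Otherwise the cells (c, r), (c+1, r) and (c+1, p) with c = inner r + 1 form a forbidden hook.
  hook-free : ∀ {p r} → p ⋖ r → b p ≤ suc (inner r)
  hook-free {p} {r} p⋖r with b p ≤? suc (inner r)
  ... | yes bp≤ = bp≤
  ... | no bp≰ = ⊥-elim (no-hook c r p (⋖⇒< p⋖r) (corner , right-of-corner , below-right))
    where
    c = suc (inner r)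
    c<bp : c < b p
    c<bp = ≰⇒> bp≰
    c<br : c < b r
    c<br = ≤-trans c<bp (b-inc (⋖⇒≤ p⋖r))
    corner : (c , r) ∈ S
    corner = outside-inner⇒∈ (s≤s z≤n) (<⇒≤ c<br) ≤-refl
    right-of-corner : (suc c , r) ∈ S
    right-of-corner = outside-inner⇒∈ (s≤s z≤n) c<br (n≤1+n _)
    below-right : (suc c , p) ∈ S
    below-right = outside-inner⇒∈ (s≤s z≤n) c<bp (s≤s (≤-trans (inner-inc (⋖⇒≤ p⋖r)) (n≤1+n _)))

  module _ {p r : Fin n} (p⋖r : p ⋖ r) (cut : b p ≤ inner r) where

    -- Cells of S in rows ≤ p lie weakly left of column b p ≤ inner r, while cells of S
    -- in rows ≥ r lie strictly right of it, so no weak connection crosses the cut.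
    step-stays-below-cut : ∀ {u v} → u ∈ S → v ∈ S → WC u v → proj₂ u F.≤ p → proj₂ v F.≤ p
    step-stays-below-cut {c , q} {c' , q'} u∈S v∈S u~v q≤p with q' F.≤? p
    ... | yes q'≤p = q'≤p
    ... | no q'≰p = ⊥-elim (crosses u~v)
      where
      r≤q' : r F.≤ q'
      r≤q' = subst (_≤ toℕ q') (sym p⋖r) (≰⇒> q'≰p)
      c<c' : c < c'
      c<c' = ≤-<-trans (proj₂ (S⊆D (c , q) u∈S))
               (≤-<-trans (b-inc q≤p)
                 (≤-<-trans cut (≤-<-trans (inner-inc r≤q') (∈⇒inner< v∈S))))
      crosses : ¬ WC (c , q) (c' , q')
      crosses (inj₁ c≡c') = <-irrefl c≡c' c<c'
      crosses (inj₂ (inj₁ (_ , q'≤q))) = q'≰p (≤-trans q'≤q q≤p)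
      crosses (inj₂ (inj₂ (c'+1≡c , _))) = <-asym c<c' (subst (c' <_) c'+1≡c ≤-refl)

    path-stays-below-cut : ∀ {x y} → Star (λ u v → u ∈ S × v ∈ S × WC u v) x y → proj₂ x F.≤ p → proj₂ y F.≤ p
    path-stays-below-cut ε x≤p = x≤p
    path-stays-below-cut ((u∈S , v∈S , u~v) ◅ path) x≤p =
      path-stays-below-cut path (step-stays-below-cut u∈S v∈S u~v x≤p)

    stops : ∀ {r₀} → (1 , r₀) ∈ S → r₀ F.≤ p → ∀ {s} → r F.≤ s → b s ≤ inner s
    stops {r₀} start r₀≤p {s} r≤s with b s ≤? inner s
    ... | yes bs≤ = bs≤
    ... | no bs≰ = ⊥-elim (<⇒≱ (subst (_≤ toℕ s) p⋖r r≤s) (path-stays-below-cut (connected _ _ start end) r₀≤p))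
      where
      end : (b s , s) ∈ S
      end = outside-inner⇒∈ (≤-trans (s≤s z≤n) (≰⇒> bs≰)) ≤-refl (≰⇒> bs≰)

  profile : ∀ {r₀} → (1 , r₀) ∈ S → SnakeProfile b r₀
  profile start = record
    { inner       = inner
    ; inner≤shape = inner≤shape
    ; inner-start = inner-start start
    ; hook-free   = hook-free
    ; stops       = λ p⋖r r₀≤p cut → stops p⋖r cut start r₀≤p
    }

module _ {n} {b : Fin n → ℕ} (b-inc : WeaklyIncreasing b) {r₀ : Fin n}
         (empty-below : ∀ r → r F.< r₀ → b r ≡ 0) where

  open SnakeProfile

  inner-below-start : (P : SnakeProfile b r₀) → ∀ {r} → r F.< r₀ → inner P r ≡ 0
  inner-below-start P {r} r<r₀ = n≤0⇒n≡0 (subst (inner P r ≤_) (empty-below r r<r₀) (inner≤shape P r))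

  stopped-value : (P : SnakeProfile b r₀) → ∀ {p r} → p ⋖ r → r₀ F.≤ p → b p ≤ inner P r → inner P r ≡ b r
  stopped-value P p⋖r r₀≤p cut = ≤-antisym (inner≤shape P _) (stops P p⋖r r₀≤p cut ≤-refl)

  continuing-value : (P : SnakeProfile b r₀) → ∀ {p r} → p ⋖ r → inner P r < b p → suc (inner P r) ≡ b p
  continuing-value P p⋖r continues = ≤-antisym continues (hook-free P p⋖r)

  stopped-exceeds-continuing : (P Q : SnakeProfile b r₀) → ∀ {p r} → p ⋖ r → r₀ F.≤ p →
    b p ≤ inner P r → inner Q r < b p → (∀ {s} → s F.< r → inner P s ≡ inner Q s) →
    sumFin (inner Q) < sumFin (inner P)
  stopped-exceeds-continuing P Q {p} {r} p⋖r r₀≤p cut continues agree =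
    sumFin-mono-< Q≤P r (<-≤-trans continues (≤-trans (b-inc (⋖⇒≤ p⋖r)) (stops P p⋖r r₀≤p cut ≤-refl)))
    where
    Q≤P : ∀ s → inner Q s ≤ inner P s
    Q≤P s with s F.<? r
    ... | yes s<r = ≤-reflexive (sym (agree s<r))
    ... | no s≮r = ≤-trans (inner≤shape Q s) (stops P p⋖r r₀≤p cut (≮⇒≥ s≮r))

  -- Row by row upwards, each profile either stops (inner r = b r) or continues
  -- (inner r = b p - 1); a profile that stops strictly before another has the larger total.
  profile-unique : (P Q : SnakeProfile b r₀) → sumFin (inner P) ≡ sumFin (inner Q) → inner P ≗ inner Q
  profile-unique P Q ΣP≡ΣQ = All.wfRec <-wellFounded 0ℓ (λ r → inner P r ≡ inner Q r) step
    where
    step : ∀ r → (∀ {s} → s F.< r → inner P s ≡ inner Q s) → inner P r ≡ inner Q r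
    step r agree with FP.<-cmp r r₀
    ... | tri< r<r₀ _ _ = trans (inner-below-start P r<r₀) (sym (inner-below-start Q r<r₀))
    ... | tri≈ _ refl _ = trans (inner-start P) (sym (inner-start Q))
    ... | tri> _ _ r₀<r with predecessor r₀<r
    ...   | p , p⋖r , r₀≤p with b p ≤? inner P r | b p ≤? inner Q r
    ...     | yes P-stops | yes Q-stops =
                trans (stopped-value P p⋖r r₀≤p P-stops) (sym (stopped-value Q p⋖r r₀≤p Q-stops))
    ...     | no P-continues | no Q-continues =
                suc-injective (trans (continuing-value P p⋖r (≰⇒> P-continues))
                                     (sym (continuing-value Q p⋖r (≰⇒> Q-continues))))
    ...     | yes P-stops | no Q-continues = contradiction ΣP≡ΣQ
                (>⇒≢ (stopped-exceeds-continuing P Q p⋖r r₀≤p P-stops (≰⇒> Q-continues) agree))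
    ...     | no P-continues | yes Q-stops = contradiction ΣP≡ΣQ
                (<⇒≢ (stopped-exceeds-continuing Q P p⋖r r₀≤p Q-stops (≰⇒> P-continues) (sym ∘ agree)))

snake-unique : ∀ {n} {b : Fin n → ℕ} {S S' : CellSet n} {r₀ : Fin n} N →
  WeaklyIncreasing b → (∀ r → b r ≤ N) → (∀ r → r F.< r₀ → b r ≡ 0) →
  IsSnake b S → IsSnake b S' → (1 , r₀) ∈ S → (1 , r₀) ∈ S' →
  sizeUpTo N S ≡ sizeUpTo N S' → S ≗ S'
snake-unique {S = S} {S'} N b-inc b≤N empty-below snake snake' start start' |S|≡|S'| x =
  bool-ext (λ x∈S → let (x∈D , x∉Da) = proj₁ (S.∈⇔outside-inner x) x∈S
                    in proj₂ (S'.∈⇔outside-inner x) (x∈D , x∉Da ∘ InD-resp (sym ∘ inner≗inner') x))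
           (λ x∈S' → let (x∈D , x∉Da') = proj₁ (S'.∈⇔outside-inner x) x∈S'
                     in proj₂ (S.∈⇔outside-inner x) (x∈D , x∉Da' ∘ InD-resp inner≗inner' x))
  where
  module S = Snake b-inc snake
  module S' = Snake b-inc snake'
  Σinner≡ : sumFin S.inner ≡ sumFin S'.inner
  Σinner≡ = +-cancelˡ-≡ (sizeUpTo N S) _ _
    (trans (S.size N b≤N) (sym (trans (cong (_+ sumFin S'.inner) |S|≡|S'|) (S'.size N b≤N))))
  inner≗inner' : S.inner ≗ S'.inner
  inner≗inner' = profile-unique b-inc empty-below (S.profile start) (S'.profile start') Σinner≡

special-snake-unique : ∀ {n} {b : Fin n → ℕ} {S S' : CellSet n} N →
  WeaklyIncreasing b → (∀ r → b r ≤ N) →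
  IsSnake b S → IsSnake b S' → IsSpecial b S → IsSpecial b S' → ¬ IsEmpty S → ¬ IsEmpty S' →
  sizeUpTo N S ≡ sizeUpTo N S' → S ≗ S'
special-snake-unique N b-inc b≤N snake snake' (inj₁ empty) _ nonempty _ = contradiction empty nonempty
special-snake-unique N b-inc b≤N snake snake' _ (inj₁ empty') _ nonempty' = contradiction empty' nonempty'
special-snake-unique {S' = S'} N b-inc b≤N snake snake'
  (inj₂ (r₀ , 1≤br₀ , below , start)) (inj₂ (r₀' , 1≤br₀' , below' , start')) _ _ =
  snake-unique N b-inc b≤N below snake snake' start
    (subst (λ r → (1 , r) ∈ S') (lowest-nonempty-row-unique 1≤br₀' below' 1≤br₀ below) start')

module _ {n} {b : Fin n → ℕ} where

  Remaining-start : ∀ (U : Fin n → CellSet n) {i} → toℕ i ≡ 0 → ∀ x → Remaining b U i x ⇔ InD b x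
  Remaining-start U i≡0 x = proj₁ , λ x∈D → x∈D , λ j j<i → contradiction (subst (toℕ j <_) i≡0 j<i) λ ()

  Remaining-⋖ : ∀ (U : Fin n → CellSet n) {j i} → j ⋖ i → ∀ x →
    Remaining b U i x ⇔ (Remaining b U j x × ¬ (x ∈ U j))
  Remaining-⋖ U {j} {i} j⋖i x =
    (λ (x∈D , x∉earlier) → (x∈D , λ k k<j → x∉earlier k (<-trans k<j (⋖⇒< j⋖i))) , x∉earlier j (⋖⇒< j⋖i)) ,
    (λ ((x∈D , x∉earlier) , x∉Uj) → x∈D , λ k k<i → x∉below-i x∉earlier x∉Uj k k<i)
    where
    x∉below-i : (∀ k → k F.< j → ¬ (x ∈ U k)) → ¬ (x ∈ U j) → ∀ k → k F.< i → ¬ (x ∈ U k)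
    x∉below-i x∉earlier x∉Uj k k<i with k F.<? j
    ... | yes k<j = x∉earlier k k<j
    ... | no k≮j rewrite FP.≤-antisym (≤-pred (subst (toℕ k <_) j⋖i k<i)) (≮⇒≥ k≮j) = x∉Uj

  Remaining-cong : ∀ {U V : Fin n → CellSet n} {i} → (∀ {j} → j F.< i → U j ≗ V j) → ∀ x →
    Remaining b U i x ⇔ Remaining b V i x
  Remaining-cong U≗V x =
    (λ (x∈D , x∉U) → x∈D , λ j j<i x∈V → x∉U j j<i (trans (U≗V j<i x) x∈V)) ,
    (λ (x∈D , x∉V) → x∈D , λ j j<i x∈U → x∉V j j<i (trans (sym (U≗V j<i x)) x∈U))

module Tabloid {n} {b : Fin n → ℕ} {U : Fin n → CellSet n} (sst : IsSST b U) where

  remaining : Fin n → Fin n → ℕ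
  remaining i = proj₁ (proj₁ sst i)

  remaining-spec : ∀ i x → Remaining b U i x ⇔ InD (remaining i) x
  remaining-spec i = proj₁ (proj₂ (proj₁ sst i))

  snake : ∀ i → IsSnake (remaining i) (U i)
  snake i = proj₁ (proj₂ (proj₂ (proj₁ sst i)))

  special : ∀ i → IsSpecial (remaining i) (U i)
  special i = proj₁ (proj₂ (proj₂ (proj₂ (proj₁ sst i))))

  empty⇔ : ∀ i → IsEmpty (U i) ⇔ (remaining i i ≡ 0)
  empty⇔ i = proj₂ (proj₂ (proj₂ (proj₂ (proj₁ sst i))))

  remaining≤shape : ∀ i r → remaining i r ≤ b r
  remaining≤shape i = InD-⊆⇒≤ (λ x → proj₁ ∘ proj₂ (remaining-spec i x))

  remaining-start : ∀ {i} → toℕ i ≡ 0 → remaining i ≗ b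
  remaining-start i≡0 = InD-injective (λ x → ⇔-trans (⇔-sym (remaining-spec _ x)) (Remaining-start {b = b} U i≡0 x))

  remaining-⋖ : ∀ {j i} → j ⋖ i → remaining i ≗ innerShape (snake j)
  remaining-⋖ {j} {i} j⋖i = InD-injective λ x →
    ⇔-trans (⇔-sym (remaining-spec i x))
    (⇔-trans (Remaining-⋖ {b = b} U j⋖i x)
    (⇔-trans ((λ (x∈R , x∉Uj) → proj₁ (remaining-spec j x) x∈R , x∉Uj) ,
              (λ (x∈D , x∉Uj) → proj₂ (remaining-spec j x) x∈D , x∉Uj))
             (innerShape-complement (snake j) x)))

  remaining-increasing : WeaklyIncreasing b → ∀ i → WeaklyIncreasing (remaining i)
  remaining-increasing b-inc = All.wfRec <-wellFounded 0ℓ (WeaklyIncreasing ∘ remaining) step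
    where
    step : ∀ i → (∀ {j} → j F.< i → WeaklyIncreasing (remaining j)) → WeaklyIncreasing (remaining i)
    step F.zero _ = WeaklyIncreasing-resp (sym ∘ remaining-start refl) b-inc
    step (F.suc j) earlier = WeaklyIncreasing-resp (sym ∘ remaining-⋖ (inject₁⋖suc j))
      (⪯-preserves-increasing (innerShape-⪯ (snake (F.inject₁ j))) (earlier (⋖⇒< (inject₁⋖suc j))))

tabloid-unique : ∀ {n} {b : Fin n → ℕ} {U V : Fin n → CellSet n} → WeaklyIncreasing b →
  IsSST b U → IsSST b V → (∀ i → weightOf b U i ≡ weightOf b V i) → ∀ i → U i ≗ V i
tabloid-unique {b = b} {U} {V} b-inc U-sst V-sst same-weight =
  All.wfRec <-wellFounded 0ℓ (λ i → U i ≗ V i) step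
  where
  module TU = Tabloid U-sst
  module TV = Tabloid V-sst

  same-remaining : ∀ {i} → (∀ {j} → j F.< i → U j ≗ V j) → TU.remaining i ≗ TV.remaining i
  same-remaining {i} earlier = InD-injective λ x →
    ⇔-trans (⇔-sym (TU.remaining-spec i x)) (⇔-trans (Remaining-cong {b = b} earlier x) (TV.remaining-spec i x))

  step : ∀ i → (∀ {j} → j F.< i → U j ≗ V j) → U i ≗ V i
  step i earlier with TU.remaining i i ≟ 0
  ... | yes row-empty = λ x →
          trans (BP.¬-not (proj₂ (TU.empty⇔ i) row-empty x))
                (sym (BP.¬-not (proj₂ (TV.empty⇔ i) (trans (sym (same-remaining earlier i)) row-empty) x)))
  ... | no row-nonempty =
          special-snake-unique (sumFin b) (TU.remaining-increasing b-inc i)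
            (λ r → ≤-trans (TU.remaining≤shape i r) (≤-sumFin b r))
            (TU.snake i) (IsSnake-resp (sym ∘ same-remaining earlier) (TV.snake i))
            (TU.special i) (IsSpecial-resp (sym ∘ same-remaining earlier) (TV.special i))
            (row-nonempty ∘ proj₁ (TU.empty⇔ i))
            (row-nonempty ∘ trans (same-remaining earlier i) ∘ proj₁ (TV.empty⇔ i))
            (same-weight i)

theorem7p8 : (n : ℕ) (μ : Fin n → ℕ) → IsPartition μ → (a : Fin n → ℕ) →
    ¬ ((Σ[ U ∈ (Fin n → CellSet n) ]
          (IsSST (rev μ) U × (∀ i → weightOf (rev μ) U i ≡ a i) × sgnOf (rev μ) U ≡ + 1))
       × (Σ[ U ∈ (Fin n → CellSet n) ]
          (IsSST (rev μ) U × (∀ i → weightOf (rev μ) U i ≡ a i) × sgnOf (rev μ) U ≡ - (+ 1))))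
theorem7p8 n μ μ-partition a ((U , U-sst , U-weight , U-sign) , (V , V-sst , V-weight , V-sign)) =
  +1≢-1 (begin
    + 1             ≡⟨ sym U-sign ⟩
    sgnOf (rev μ) U ≡⟨ sgnOf-cong (rev μ) U≗V ⟩
    sgnOf (rev μ) V ≡⟨ V-sign ⟩
    - (+ 1)         ∎)
  where
  open ≡-Reasoning
  U≗V : ∀ i → U i ≗ V i
  U≗V = tabloid-unique (rev-increasing μ-partition) U-sst V-sst (λ i → trans (U-weight i) (sym (V-weight i)))
  +1≢-1 : + 1 ≢ - (+ 1)
  +1≢-1 ()
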